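{- Let $\beta$ be a complex number and let $n\ge 1$ be an integer. For integers $m\ge 0$ put $c_{n,m}=[x^n]\,{}_{(\beta)}a^{m}(x)$, where ${}_{(\beta)}a^{m}(x)$ is the $m$-th power of the generalized binomial series ${}_{(\beta)}a(x)$. Define the formal power series ${}_{(\beta)}\alpha_n(x)=(1-x)^{n+1}\sum_{m\ge 0}c_{n,m}x^m$. Then $${}_{(\beta)}\alpha_n(x)=\frac{1}{n}\sum_{m=0}^{n}\binom{n(1-\beta)}{m-1}\binom{n\beta}{n-m}x^m .$$
   Context: For complex $y$ and integer $k$, $\binom{y}{k}=y(y-1)\cdots(y-k+1)/k!$ if $k\ge 0$ and $\binom{y}{k}=0$ if $k<0$. The generalized binomial series ${}_{(\beta)}a(x)$ is the formal power series whose powers are ${}_{(\beta)}a^{\varphi}(x)=\sum_{k\ge0}\frac{\varphi}{\varphi+k\beta}\binom{\varphi+k\beta}{k}x^k$ for every $\varphi$; here the coefficient of $x^k$ for $k\ge1$ is to be read as the polynomial $\frac{\varphi}{k}\binom{\varphi+k\beta-1}{k-1}$ in $\varphi,\beta$ (so the coefficient of $x^k$, $k\ge 1$, vanishes for $\varphi=0$), and the coefficient of $x^0$ is $1$. (E.g. ${}_{(0)}a(x)=1+x$, ${}_{(1)}a(x)=1/(1-x)$.) Equivalently, $\sum_{m\ge0}c_{n,m}x^m$ is the generating function of the $n$-th descending diagonal of the Riordan matrix whose $m$-th column has generating function $(x\,{}_{(\beta)}a(x))^m$. -}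

module Defs where

open import Level using (Level)
open import Data.Nat as ℕ using (ℕ; zero; suc; _∸_; _≤ᵇ_)
open import Data.Integer as ℤ using (ℤ; +_; -[1+_])
open import Data.Bool using (if_then_else_)
open import Algebra.Bundles using (CommutativeRing)

-- All definitions are over a commutative ring R together with a function
-- inv such that inv k is (intended to be) the inverse of (k+1)·1 in R,
-- i.e. R is a Q-algebra (e.g. the complex numbers).
module Over {c ℓ : Level} (R : CommutativeRing c ℓ) (inv : ℕ → CommutativeRing.Carrier R) where
  open CommutativeRing R

  natCast : ℕ → Carrier
  natCast zero    = 0#
  natCast (suc k) = 1# + natCast k

  signPow : ℕ → Carrier
  signPow zero    = 1#
  signPow (suc i) = - (signPow i)

  falling : Carrier → ℕ → Carrier
  falling y zero    = 1#
  falling y (suc k) = falling y k * (y - natCast k)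

  invFact : ℕ → Carrier
  invFact zero    = 1#
  invFact (suc k) = invFact k * inv k

  binomℕ : Carrier → ℕ → Carrier
  binomℕ y k = falling y k * invFact k

  binom : Carrier → ℤ → Carrier
  binom y (+ k)    = binomℕ y k
  binom y -[1+ k ] = 0#

  FPS : Set c
  FPS = ℕ → Carrier

  sumUpTo : ℕ → (ℕ → Carrier) → Carrier
  sumUpTo zero    f = f 0
  sumUpTo (suc j) f = sumUpTo j f + f (suc j)

  _·_ : FPS → FPS → FPS
  (f · g) j = sumUpTo j (λ i → f i * g (j ∸ i))

  oneFPS : FPS
  oneFPS zero    = 1#
  oneFPS (suc _) = 0#

  oneMinusX : FPS
  oneMinusX zero          = 1#
  oneMinusX (suc zero)    = - 1#
  oneMinusX (suc (suc _)) = 0#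

  _^ᶠ_ : FPS → ℕ → FPS
  f ^ᶠ zero  = oneFPS
  f ^ᶠ suc k = f · (f ^ᶠ k)

  -- coefficient of x^k in the power  (β)a^φ(x)  of the generalized binomial
  -- series:  1 for k = 0,  (φ/k) binom(φ + kβ - 1, k - 1)  for k ≥ 1.
  gbsPowCoeff : (β φ : Carrier) → ℕ → Carrier
  gbsPowCoeff β φ zero     = 1#
  gbsPowCoeff β φ (suc k') =
    (φ * inv k') * binomℕ (φ + natCast (suc k') * β - 1#) k'

  gbsPow : (β φ : Carrier) → FPS
  gbsPow β φ = gbsPowCoeff β φ

  cnm : (β : Carrier) → ℕ → ℕ → Carrier
  cnm β n m = gbsPow β (natCast m) n

  alpha : (β : Carrier) → ℕ → FPS
  alpha β n = (oneMinusX ^ᶠ suc n) · (λ m → cnm β n m)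

  -- the right-hand side: (1/n) Σ_{m=0}^{n} binom(n(1-β), m-1) binom(nβ, n-m) x^m
  -- (here 1/n = inv (n ∸ 1), meaningful for n ≥ 1)
  rhs : (β : Carrier) → ℕ → FPS
  rhs β n m =
    if m ≤ᵇ n
    then inv (n ∸ 1) * (binom (natCast n * (1# - β)) (+ m ℤ.- + 1)
                        * binom (natCast n * β) (+ n ℤ.- + m))
    else 0#

-- Multiplying a series by 1 − x takes backward differences of its coefficients, so the
-- coefficients of α_n are Δ^(n+1) applied to m ↦ c_{n,m} = (1/n)·m·binom(m+y−1, n−1), y = nβ.
-- The sequence m·binom(m+y−1, n−1) is the top member G_n of the family
--   G_s(k) = n·binom(k+y, s) − y·binom(k+y−1, s−1),
-- in which, by Pascal's rule, G_{s+1} is an antidifference of G_s. Hence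
-- Δ^(s+2) G_{s+1} = G_{s+1}(0)·Δ^(s+1)(1) + x·Δ^(s+1) G_s, where Δ^d(1) has coefficients
-- (−1)^m binom(d, m), and induction on s gives
--   Δ^(s+1) G_s (m) = binom(y, s−m)·((n−s)·binom(s−y, m) + binom(s−y, m−1)),
-- the step being Pascal's rule, the trinomial revision
-- binom(y, s+1)·binom(s+1, m+1) = binom(y, s−m)·binom(y−s+m, m+1) and upper negation.
-- For s = n the first summand vanishes.

module Submission where

open import Defs
open import Data.Nat using (ℕ; suc; _≤_)
open import Algebra.Bundles using (CommutativeRing)

open import Data.Nat as ℕ using (zero; s≤s; _<_; _∸_; _≤ᵇ_)
import Data.Nat.Properties as ℕP
open import Data.Integer as ℤ using (ℤ; +_; -[1+_]; _⊖_)
import Data.Integer.Properties as ℤP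
open import Data.Sign as Sign using ()
open import Data.Bool using (true; false; T)
open import Data.Maybe using (Maybe; nothing; just)
open import Data.Product using (_,_)
open import Relation.Nullary using (yes; no)
open import Relation.Binary.PropositionalEquality as P using (_≡_)
import Algebra.Solver.Ring.AlmostCommutativeRing as ACR
import Algebra.Solver.Ring

module FiniteCalculus {c ℓ} (R : CommutativeRing c ℓ) (inv : ℕ → CommutativeRing.Carrier R) where
  open CommutativeRing R hiding (zero)
  open Over R inv
  open import Relation.Binary.Reasoning.Setoid setoid
  open import Algebra.Properties.Ring ring using (-‿distribˡ-*; -‿distribʳ-*; -‿involutive; -0#≈0#)
  open import Algebra.Properties.AbelianGroup +-abelianGroup using (⁻¹-∙-comm)

  natCast-+ : ∀ m n → natCast (m ℕ.+ n) ≈ natCast m + natCast n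
  natCast-+ zero    n = sym (+-identityˡ _)
  natCast-+ (suc m) n = trans (+-congˡ (natCast-+ m n)) (sym (+-assoc _ _ _))

  natCast-* : ∀ m n → natCast (m ℕ.* n) ≈ natCast m * natCast n
  natCast-* zero    n = sym (zeroˡ _)
  natCast-* (suc m) n = begin
    natCast (n ℕ.+ m ℕ.* n)                 ≈⟨ natCast-+ n (m ℕ.* n) ⟩
    natCast n + natCast (m ℕ.* n)           ≈⟨ +-cong (sym (*-identityˡ _)) (natCast-* m n) ⟩
    1# * natCast n + natCast m * natCast n  ≈⟨ distribʳ _ _ _ ⟨
    (1# + natCast m) * natCast n            ∎

  intCast : ℤ → Carrier
  intCast (+ n)    = natCast n
  intCast -[1+ n ] = - natCast (suc n)

  intCast-⊖ : ∀ m n → intCast (m ⊖ n) ≈ natCast m - natCast n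
  intCast-⊖ zero    zero    = sym (-‿inverseʳ 0#)
  intCast-⊖ (suc m) zero    = sym (trans (+-congˡ -0#≈0#) (+-identityʳ _))
  intCast-⊖ zero    (suc n) = sym (+-identityˡ _)
  intCast-⊖ (suc m) (suc n) = begin
    intCast (suc m ⊖ suc n)             ≡⟨ P.cong intCast (ℤP.[1+m]⊖[1+n]≡m⊖n m n) ⟩
    intCast (m ⊖ n)                     ≈⟨ intCast-⊖ m n ⟩
    natCast m - natCast n               ≈⟨ +-identityˡ _ ⟨
    0# + (natCast m - natCast n)        ≈⟨ +-congʳ (-‿inverseʳ 1#) ⟨
    (1# - 1#) + (natCast m - natCast n) ≈⟨ +-assoc _ _ _ ⟩
    1# + (- 1# + (natCast m - natCast n)) ≈⟨ +-congˡ (+-assoc _ _ _) ⟨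
    1# + ((- 1# + natCast m) - natCast n) ≈⟨ +-congˡ (+-congʳ (+-comm _ _)) ⟩
    1# + ((natCast m - 1#) - natCast n) ≈⟨ +-congˡ (+-assoc _ _ _) ⟩
    1# + (natCast m + (- 1# - natCast n)) ≈⟨ +-assoc _ _ _ ⟨
    natCast (suc m) + (- 1# - natCast n) ≈⟨ +-congˡ (⁻¹-∙-comm 1# (natCast n)) ⟩
    natCast (suc m) - natCast (suc n)   ∎

  intCast-+ : ∀ a b → intCast (a ℤ.+ b) ≈ intCast a + intCast b
  intCast-+ (+ m)    (+ n)    = natCast-+ m n
  intCast-+ (+ m)    -[1+ n ] = intCast-⊖ m (suc n)
  intCast-+ -[1+ m ] (+ n)    = trans (intCast-⊖ n (suc m)) (+-comm _ _)
  intCast-+ -[1+ m ] -[1+ n ] = begin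
    - natCast (suc (suc (m ℕ.+ n)))       ≡⟨ P.cong (λ k → - natCast (suc k)) (ℕP.+-suc m n) ⟨
    - natCast (suc m ℕ.+ suc n)           ≈⟨ -‿cong (natCast-+ (suc m) (suc n)) ⟩
    - (natCast (suc m) + natCast (suc n)) ≈⟨ ⁻¹-∙-comm _ _ ⟨
    - natCast (suc m) - natCast (suc n)   ∎

  intCast-pos◃ : ∀ k → intCast (Sign.+ ℤ.◃ k) ≈ natCast k
  intCast-pos◃ zero    = refl
  intCast-pos◃ (suc k) = refl

  intCast-neg◃ : ∀ k → intCast (Sign.- ℤ.◃ k) ≈ - natCast k
  intCast-neg◃ zero    = sym -0#≈0#
  intCast-neg◃ (suc k) = refl

  intCast-* : ∀ a b → intCast (a ℤ.* b) ≈ intCast a * intCast b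
  intCast-* (+ m) (+ n) = trans (intCast-pos◃ (m ℕ.* n)) (natCast-* m n)
  intCast-* (+ m) -[1+ n ] =
    trans (intCast-neg◃ (m ℕ.* suc n)) (trans (-‿cong (natCast-* m (suc n))) (-‿distribʳ-* _ _))
  intCast-* -[1+ m ] (+ n) =
    trans (intCast-neg◃ (suc m ℕ.* n)) (trans (-‿cong (natCast-* (suc m) n)) (-‿distribˡ-* _ _))
  intCast-* -[1+ m ] -[1+ n ] = begin
    intCast (Sign.+ ℤ.◃ (suc m ℕ.* suc n))       ≈⟨ intCast-pos◃ (suc m ℕ.* suc n) ⟩
    natCast (suc m ℕ.* suc n)                    ≈⟨ natCast-* (suc m) (suc n) ⟩
    natCast (suc m) * natCast (suc n)            ≈⟨ -‿involutive _ ⟨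
    - - (natCast (suc m) * natCast (suc n))      ≈⟨ -‿cong (-‿distribʳ-* _ _) ⟩
    - (natCast (suc m) * - natCast (suc n))      ≈⟨ -‿distribˡ-* _ _ ⟩
    - natCast (suc m) * - natCast (suc n)        ∎

  intCast-neg : ∀ a → intCast (ℤ.- a) ≈ - intCast a
  intCast-neg (+ zero)  = sym -0#≈0#
  intCast-neg (+ suc n) = refl
  intCast-neg -[1+ n ]  = sym (-‿involutive _)

  -- The solver evaluates its constants 0 and 1 with this variant of intCast, which sends
  -- them to 0# and 1# on the nose; its identities then unify with goals written with 0# and 1#.
  intCastₛ : ℤ → Carrier
  intCastₛ (+ 1) = 1#
  intCastₛ z     = intCast z

  intCastₛ≈intCast : ∀ z → intCastₛ z ≈ intCast z
  intCastₛ≈intCast (+ 0)           = refl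
  intCastₛ≈intCast (+ 1)           = sym (+-identityʳ 1#)
  intCastₛ≈intCast (+ suc (suc n)) = refl
  intCastₛ≈intCast -[1+ n ]        = refl

  intCastₛ-morphism : ℤ.+-*-rawRing ACR.-Raw-AlmostCommutative⟶ ACR.fromCommutativeRing R
  intCastₛ-morphism = record
    { ⟦_⟧    = intCastₛ
    ; +-homo = λ a b → fromIntCast {a} {b} (a ℤ.+ b) (intCast-+ a b) +-cong
    ; *-homo = λ a b → fromIntCast {a} {b} (a ℤ.* b) (intCast-* a b) *-cong
    ; -‿homo = λ a → trans (intCastₛ≈intCast (ℤ.- a)) (trans (intCast-neg a) (-‿cong (sym (intCastₛ≈intCast a))))
    ; 0-homo = refl
    ; 1-homo = refl
    }
    where
    fromIntCast : ∀ {a b} {_∙_ : Carrier → Carrier → Carrier} c → intCast c ≈ intCast a ∙ intCast b →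
            (∀ {x x′ y y′} → x ≈ x′ → y ≈ y′ → (x ∙ y) ≈ (x′ ∙ y′)) →
            intCastₛ c ≈ intCastₛ a ∙ intCastₛ b
    fromIntCast {a} {b} c eq ∙-cong =
      trans (intCastₛ≈intCast c) (trans eq (∙-cong (sym (intCastₛ≈intCast a)) (sym (intCastₛ≈intCast b))))

  intCastₛ-equal? : ∀ a b → Maybe (intCastₛ a ≈ intCastₛ b)
  intCastₛ-equal? a b with a ℤ.≟ b
  ... | yes P.refl = just refl
  ... | no _       = nothing

  open Algebra.Solver.Ring ℤ.+-*-rawRing (ACR.fromCommutativeRing R) intCastₛ-morphism intCastₛ-equal?
    using (solve; _:=_; _:+_; _:*_; _:-_; :-_; con; Polynomial)

  0ₚ 1ₚ : ∀ {n} → Polynomial n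
  0ₚ = con (+ 0)
  1ₚ = con (+ 1)

  -- Cauchy products and backward differences

  infix 4 _≈ᶠ_
  _≈ᶠ_ : FPS → FPS → Set ℓ
  f ≈ᶠ g = ∀ m → f m ≈ g m

  sumUpTo-cong : ∀ j {f g : ℕ → Carrier} → f ≈ᶠ g → sumUpTo j f ≈ sumUpTo j g
  sumUpTo-cong zero    f≈g = f≈g 0
  sumUpTo-cong (suc j) f≈g = +-cong (sumUpTo-cong j f≈g) (f≈g (suc j))

  sumUpTo-suc : ∀ j (f : ℕ → Carrier) → sumUpTo (suc j) f ≈ f 0 + sumUpTo j (λ i → f (suc i))
  sumUpTo-suc zero    f = refl
  sumUpTo-suc (suc j) f = trans (+-congʳ (sumUpTo-suc j f)) (+-assoc _ _ _)

  sumUpTo-zero : ∀ j {f : ℕ → Carrier} → (∀ i → f i ≈ 0#) → sumUpTo j f ≈ 0#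
  sumUpTo-zero zero    f≈0 = f≈0 0
  sumUpTo-zero (suc j) f≈0 = trans (+-cong (sumUpTo-zero j f≈0) (f≈0 (suc j))) (+-identityʳ 0#)

  sumUpTo-sub : ∀ j (f g : ℕ → Carrier) → sumUpTo j (λ i → f i - g i) ≈ sumUpTo j f - sumUpTo j g
  sumUpTo-sub zero    f g = refl
  sumUpTo-sub (suc j) f g = trans (+-congʳ (sumUpTo-sub j f g))
    (solve 4 (λ a b x y → (a :- b) :+ (x :- y) := (a :+ x) :- (b :+ y)) refl _ _ _ _)

  ·-congʳ : ∀ {P Q} c → P ≈ᶠ Q → P · c ≈ᶠ Q · c
  ·-congʳ c P≈Q j = sumUpTo-cong j (λ i → *-congʳ (P≈Q i))

  ·-identityˡ : ∀ c → oneFPS · c ≈ᶠ c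
  ·-identityˡ c zero    = *-identityˡ _
  ·-identityˡ c (suc m) = begin
    (oneFPS · c) (suc m)                              ≈⟨ sumUpTo-suc m _ ⟩
    1# * c (suc m) + sumUpTo m (λ i → 0# * c (m ∸ i)) ≈⟨ +-cong (*-identityˡ _) (sumUpTo-zero m (λ _ → zeroˡ _)) ⟩
    c (suc m) + 0#                                    ≈⟨ +-identityʳ _ ⟩
    c (suc m)                                         ∎

  -- the backward difference, reading f (-1) as 0
  Δ : FPS → FPS
  Δ f zero    = f zero
  Δ f (suc m) = f (suc m) - f m

  Δ^ : ℕ → FPS → FPS
  Δ^ zero    f = f
  Δ^ (suc d) f = Δ (Δ^ d f)

  Δ-cong : ∀ {f g} → f ≈ᶠ g → Δ f ≈ᶠ Δ g
  Δ-cong f≈g zero    = f≈g zero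
  Δ-cong f≈g (suc m) = +-cong (f≈g (suc m)) (-‿cong (f≈g m))

  Δ^-cong : ∀ d {f g} → f ≈ᶠ g → Δ^ d f ≈ᶠ Δ^ d g
  Δ^-cong zero    f≈g = f≈g
  Δ^-cong (suc d) f≈g = Δ-cong (Δ^-cong d f≈g)

  Δ^-suc : ∀ d f → Δ^ (suc d) f ≈ᶠ Δ^ d (Δ f)
  Δ^-suc zero    f = λ _ → refl
  Δ^-suc (suc d) f = Δ-cong (Δ^-suc d f)

  Δ^-scale : ∀ d a f → Δ^ d (λ k → a * f k) ≈ᶠ (λ k → a * Δ^ d f k)
  Δ^-scale zero    a f = λ _ → refl
  Δ^-scale (suc d) a f = λ m → trans (Δ-cong (Δ^-scale d a f) m) (Δ-scale m)
    where
    Δ-scale : ∀ m → Δ (λ k → a * Δ^ d f k) m ≈ a * Δ (Δ^ d f) m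
    Δ-scale zero    = refl
    Δ-scale (suc m) = solve 3 (λ a x y → a :* x :- a :* y := a :* (x :- y)) refl _ _ _

  oneMinusX-· : ∀ P → oneMinusX · P ≈ᶠ Δ P
  oneMinusX-· P zero    = *-identityˡ _
  oneMinusX-· P (suc j) = begin
    (oneMinusX · P) (suc j)
      ≈⟨ sumUpTo-suc j _ ⟩
    1# * P (suc j) + sumUpTo j (λ i → oneMinusX (suc i) * P (j ∸ i))
      ≈⟨ +-congˡ (higherTerms j) ⟩
    1# * P (suc j) + - 1# * P j
      ≈⟨ solve 2 (λ a b → 1ₚ :* a :+ (:- 1ₚ) :* b := a :- b) refl _ _ ⟩
    Δ P (suc j) ∎
    where
    higherTerms : ∀ j → sumUpTo j (λ i → oneMinusX (suc i) * P (j ∸ i)) ≈ - 1# * P j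
    higherTerms zero    = refl
    higherTerms (suc j) = trans (sumUpTo-suc j _)
      (trans (+-congˡ (sumUpTo-zero j (λ _ → zeroˡ _))) (+-identityʳ _))

  Δ-·ˡ : ∀ P c → Δ P · c ≈ᶠ Δ (P · c)
  Δ-·ˡ P c zero    = refl
  Δ-·ˡ P c (suc m) = begin
    sumUpTo (suc m) (λ i → Δ P i * c (suc m ∸ i))
      ≈⟨ sumUpTo-suc m _ ⟩
    P 0 * c (suc m) + sumUpTo m (λ i → (P (suc i) - P i) * c (m ∸ i))
      ≈⟨ +-congˡ (sumUpTo-cong m (λ i → solve 3 (λ a b x → (a :- b) :* x := a :* x :- b :* x) refl _ _ _)) ⟩
    P 0 * c (suc m) + sumUpTo m (λ i → P (suc i) * c (m ∸ i) - P i * c (m ∸ i))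
      ≈⟨ +-congˡ (sumUpTo-sub m _ _) ⟩
    P 0 * c (suc m) + (sumUpTo m (λ i → P (suc i) * c (m ∸ i)) - (P · c) m)
      ≈⟨ +-assoc _ _ _ ⟨
    (P 0 * c (suc m) + sumUpTo m (λ i → P (suc i) * c (m ∸ i))) - (P · c) m
      ≈⟨ +-congʳ (sumUpTo-suc m (λ i → P i * c (suc m ∸ i))) ⟨
    (P · c) (suc m) - (P · c) m ∎

  oneMinusX^-· : ∀ d c → (oneMinusX ^ᶠ d) · c ≈ᶠ Δ^ d c
  oneMinusX^-· zero    c m = ·-identityˡ c m
  oneMinusX^-· (suc d) c m = begin
    ((oneMinusX · P) · c) m ≈⟨ ·-congʳ c (oneMinusX-· P) m ⟩
    (Δ P · c) m             ≈⟨ Δ-·ˡ P c m ⟩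
    Δ (P · c) m             ≈⟨ Δ-cong (oneMinusX^-· d c) m ⟩
    Δ^ (suc d) c m          ∎
    where
    P : FPS
    P = oneMinusX ^ᶠ d

  shift : FPS → FPS
  shift f zero    = 0#
  shift f (suc m) = f m

  Δ^-pulse+shift : ∀ d a g →
    Δ^ d (λ k → a * oneFPS k + shift g k) ≈ᶠ (λ m → a * Δ^ d oneFPS m + shift (Δ^ d g) m)
  Δ^-pulse+shift zero    a g = λ _ → refl
  Δ^-pulse+shift (suc d) a g m = trans (Δ-cong (Δ^-pulse+shift d a g) m) (Δ-pulse+shift m)
    where
    Δ-pulse+shift : ∀ m → Δ (λ k → a * Δ^ d oneFPS k + shift (Δ^ d g) k) m
                          ≈ a * Δ^ (suc d) oneFPS m + shift (Δ^ (suc d) g) m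
    Δ-pulse+shift zero          = refl
    Δ-pulse+shift (suc zero)    =
      solve 4 (λ a x y h → (a :* x :+ h) :- (a :* y :+ 0ₚ) := a :* (x :- y) :+ h) refl _ _ _ _
    Δ-pulse+shift (suc (suc m)) =
      solve 5 (λ a x y h h′ → (a :* x :+ h) :- (a :* y :+ h′) := a :* (x :- y) :+ (h :- h′)) refl _ _ _ _ _

  Δ^-suc-antidifference : ∀ d {f g} → (∀ k → f (suc k) - f k ≈ g k) →
    Δ^ (suc d) f ≈ᶠ (λ m → f 0 * Δ^ d oneFPS m + shift (Δ^ d g) m)
  Δ^-suc-antidifference d {f} {g} Δf≈g m = begin
    Δ^ (suc d) f m                            ≈⟨ Δ^-suc d f m ⟩
    Δ^ d (Δ f) m                              ≈⟨ Δ^-cong d Δf≈pulse+shift m ⟩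
    Δ^ d (λ k → f 0 * oneFPS k + shift g k) m ≈⟨ Δ^-pulse+shift d (f 0) g m ⟩
    f 0 * Δ^ d oneFPS m + shift (Δ^ d g) m    ∎
    where
    Δf≈pulse+shift : Δ f ≈ᶠ (λ k → f 0 * oneFPS k + shift g k)
    Δf≈pulse+shift zero    = solve 1 (λ x → x := x :* 1ₚ :+ 0ₚ) refl _
    Δf≈pulse+shift (suc k) = trans (Δf≈g k) (solve 2 (λ x y → y := x :* 0ₚ :+ y) refl _ _)

  -- Binomial coefficients

  falling-cong : ∀ k {a b} → a ≈ b → falling a k ≈ falling b k
  falling-cong zero    a≈b = refl
  falling-cong (suc k) a≈b = *-cong (falling-cong k a≈b) (+-congʳ a≈b)

  binomℕ-cong : ∀ k {a b} → a ≈ b → binomℕ a k ≈ binomℕ b k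
  binomℕ-cong k a≈b = *-congʳ (falling-cong k a≈b)

  falling-sucˡ : ∀ k a → falling a (suc k) ≈ a * falling (a - 1#) k
  falling-sucˡ zero    a = solve 1 (λ a → 1ₚ :* (a :- 0ₚ) := a :* 1ₚ) refl a
  falling-sucˡ (suc k) a = trans (*-congʳ (falling-sucˡ k a))
    (solve 3 (λ a f x → (a :* f) :* (a :- (1ₚ :+ x)) := a :* (f :* ((a :- 1ₚ) :- x))) refl a _ _)

  falling-+ : ∀ j p a → falling a (j ℕ.+ p) ≈ falling a p * falling (a - natCast p) j
  falling-+ zero    p a = sym (*-identityʳ _)
  falling-+ (suc j) p a = begin
    falling a (j ℕ.+ p) * (a - natCast (j ℕ.+ p))
      ≈⟨ *-cong (falling-+ j p a) (+-congˡ (-‿cong (natCast-+ j p))) ⟩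
    (falling a p * falling (a - natCast p) j) * (a - (natCast j + natCast p))
      ≈⟨ solve 5 (λ f g a x y → (f :* g) :* (a :- (x :+ y)) := f :* (g :* ((a :- y) :- x))) refl _ _ a _ _ ⟩
    falling a p * (falling (a - natCast p) j * ((a - natCast p) - natCast j)) ∎

  falling-natCast-vanish : ∀ N q → falling (natCast N) (suc (N ℕ.+ q)) ≈ 0#
  falling-natCast-vanish N zero    rewrite ℕP.+-identityʳ N = trans (*-congˡ (-‿inverseʳ _)) (zeroʳ _)
  falling-natCast-vanish N (suc q) rewrite ℕP.+-suc N q     = trans (*-congʳ (falling-natCast-vanish N q)) (zeroˡ _)

  signPow-falling : ∀ k x → signPow k * falling x k ≈ falling (natCast k - 1# - x) k
  signPow-falling zero    x = *-identityˡ _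
  signPow-falling (suc k) x = sym (begin
    falling (natCast (suc k) - 1# - x) (suc k)
      ≈⟨ falling-sucˡ k _ ⟩
    (natCast (suc k) - 1# - x) * falling (natCast (suc k) - 1# - x - 1#) k
      ≈⟨ *-congˡ (falling-cong k (solve 2 (λ n x → (1ₚ :+ n) :- 1ₚ :- x :- 1ₚ := n :- 1ₚ :- x) refl _ x)) ⟩
    (natCast (suc k) - 1# - x) * falling (natCast k - 1# - x) k
      ≈⟨ *-congˡ (signPow-falling k x) ⟨
    (natCast (suc k) - 1# - x) * (signPow k * falling x k)
      ≈⟨ solve 4 (λ s f x n → ((1ₚ :+ n) :- 1ₚ :- x) :* (s :* f) := (:- s) :* (f :* (x :- n))) refl _ _ x _ ⟩
    signPow (suc k) * falling x (suc k) ∎)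

  binomPred : Carrier → ℕ → Carrier
  binomPred a k = binom a (+ k ℤ.- + 1)

  binomPred-cong : ∀ k {a b} → a ≈ b → binomPred a k ≈ binomPred b k
  binomPred-cong zero    a≈b = refl
  binomPred-cong (suc k) a≈b = binomℕ-cong k a≈b

  binom-[m+p]⊖m : ∀ a m p → binom a ((m ℕ.+ p) ⊖ m) ≡ binomℕ a p
  binom-[m+p]⊖m a zero    p = P.refl
  binom-[m+p]⊖m a (suc m) p = P.trans (P.cong (binom a) (ℤP.[1+m]⊖[1+n]≡m⊖n (m ℕ.+ p) m)) (binom-[m+p]⊖m a m p)

  binom-⊖-< : ∀ a {s m} → s < m → binom a (s ⊖ m) ≡ 0#
  binom-⊖-< a {zero}  {suc m} _         = P.refl
  binom-⊖-< a {suc s} {suc m} (s≤s s<m) = P.trans (P.cong (binom a) (ℤP.[1+m]⊖[1+n]≡m⊖n s m)) (binom-⊖-< a s<m)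

  module _ (natCast-inv : ∀ k → natCast (suc k) * inv k ≈ 1#) where

    pascal : ∀ a k → binomℕ (1# + a) (suc k) ≈ binomℕ a (suc k) + binomℕ a k
    pascal a k = begin
      falling (1# + a) (suc k) * (invFact k * inv k)
        ≈⟨ *-congʳ (falling-sucˡ k (1# + a)) ⟩
      ((1# + a) * falling ((1# + a) - 1#) k) * (invFact k * inv k)
        ≈⟨ *-congʳ (*-congˡ (falling-cong k (solve 1 (λ a → (1ₚ :+ a) :- 1ₚ := a) refl a))) ⟩
      ((1# + a) * falling a k) * (invFact k * inv k)
        ≈⟨ solve 5 (λ a f n i v → ((1ₚ :+ a) :* f) :* (i :* v)
                                := (f :* (a :- n)) :* (i :* v) :+ (f :* i) :* ((1ₚ :+ n) :* v)) refl a _ _ _ _ ⟩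
      (falling a k * (a - natCast k)) * (invFact k * inv k) + (falling a k * invFact k) * (natCast (suc k) * inv k)
        ≈⟨ +-congˡ (trans (*-congˡ (natCast-inv k)) (*-identityʳ _)) ⟩
      binomℕ a (suc k) + binomℕ a k ∎

    pascal-pred : ∀ a k → binomℕ (1# + a) k ≈ binomℕ a k + binomPred a k
    pascal-pred a zero    = sym (+-identityʳ _)
    pascal-pred a (suc k) = pascal a k

    absorption : ∀ a k → a * binomPred (a - 1#) k ≈ natCast k * binomℕ a k
    absorption a zero    = solve 2 (λ a b → a :* 0ₚ := 0ₚ :* b) refl a _
    absorption a (suc k) = sym (begin
      natCast (suc k) * (falling a (suc k) * (invFact k * inv k))
        ≈⟨ *-congˡ (*-congʳ (falling-sucˡ k a)) ⟩
      natCast (suc k) * ((a * falling (a - 1#) k) * (invFact k * inv k))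
        ≈⟨ solve 5 (λ a f n i v → (1ₚ :+ n) :* ((a :* f) :* (i :* v)) := (a :* (f :* i)) :* ((1ₚ :+ n) :* v)) refl a _ _ _ _ ⟩
      (a * (falling (a - 1#) k * invFact k)) * (natCast (suc k) * inv k)
        ≈⟨ trans (*-congˡ (natCast-inv k)) (*-identityʳ _) ⟩
      a * (falling (a - 1#) k * invFact k) ∎)

    falling-natCast-invFact : ∀ j p → falling (natCast (j ℕ.+ p)) j * invFact (j ℕ.+ p) ≈ invFact p
    falling-natCast-invFact zero    p = *-identityˡ _
    falling-natCast-invFact (suc j) p = begin
      falling (natCast (suc N)) (suc j) * (invFact N * inv N)
        ≈⟨ *-congʳ (falling-sucˡ j _) ⟩
      (natCast (suc N) * falling (natCast (suc N) - 1#) j) * (invFact N * inv N)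
        ≈⟨ *-congʳ (*-congˡ (falling-cong j (solve 1 (λ a → (1ₚ :+ a) :- 1ₚ := a) refl _))) ⟩
      (natCast (suc N) * falling (natCast N) j) * (invFact N * inv N)
        ≈⟨ solve 4 (λ n f i v → (n :* f) :* (i :* v) := (f :* i) :* (n :* v)) refl _ _ _ _ ⟩
      (falling (natCast N) j * invFact N) * (natCast (suc N) * inv N)
        ≈⟨ *-cong (falling-natCast-invFact j p) (natCast-inv N) ⟩
      invFact p * 1#
        ≈⟨ *-identityʳ _ ⟩
      invFact p ∎
      where
      N : ℕ
      N = j ℕ.+ p

    binomℕ-trinomial : ∀ j p a → binomℕ a (j ℕ.+ p) * binomℕ (natCast (j ℕ.+ p)) j ≈ binomℕ a p * binomℕ (a - natCast p) j
    binomℕ-trinomial j p a = begin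
      (falling a (j ℕ.+ p) * invFact (j ℕ.+ p)) * (falling (natCast (j ℕ.+ p)) j * invFact j)
        ≈⟨ *-congʳ (*-congʳ (falling-+ j p a)) ⟩
      ((falling a p * falling (a - natCast p) j) * invFact (j ℕ.+ p)) * (falling (natCast (j ℕ.+ p)) j * invFact j)
        ≈⟨ solve 5 (λ f g i h k → ((f :* g) :* i) :* (h :* k) := (f :* g) :* ((h :* i) :* k)) refl _ _ _ _ _ ⟩
      (falling a p * falling (a - natCast p) j) * ((falling (natCast (j ℕ.+ p)) j * invFact (j ℕ.+ p)) * invFact j)
        ≈⟨ *-congˡ (*-congʳ (falling-natCast-invFact j p)) ⟩
      (falling a p * falling (a - natCast p) j) * (invFact p * invFact j)
        ≈⟨ solve 4 (λ f g i k → (f :* g) :* (i :* k) := (f :* i) :* (g :* k)) refl _ _ _ _ ⟩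
      binomℕ a p * binomℕ (a - natCast p) j ∎

    binomℕ-signPow-trinomial : ∀ a s m →
      binomℕ a (suc s) * (signPow (suc m) * binomℕ (natCast (suc s)) (suc m)) ≈ binom a (s ⊖ m) * binomℕ (natCast s - a) (suc m)
    binomℕ-signPow-trinomial a s m with m ℕ.≤? s
    ... | yes m≤s with p , P.refl ← ℕP.m≤n⇒∃[o]m+o≡n m≤s = begin
      binomℕ a (suc m ℕ.+ p) * (signPow (suc m) * binomℕ (natCast (suc m ℕ.+ p)) (suc m))
        ≈⟨ solve 3 (λ b σ c → b :* (σ :* c) := σ :* (b :* c)) refl _ _ _ ⟩
      signPow (suc m) * (binomℕ a (suc m ℕ.+ p) * binomℕ (natCast (suc m ℕ.+ p)) (suc m))
        ≈⟨ *-congˡ (binomℕ-trinomial (suc m) p a) ⟩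
      signPow (suc m) * (binomℕ a p * binomℕ (a - natCast p) (suc m))
        ≈⟨ solve 4 (λ σ b f i → σ :* (b :* (f :* i)) := b :* ((σ :* f) :* i)) refl _ _ _ _ ⟩
      binomℕ a p * ((signPow (suc m) * falling (a - natCast p) (suc m)) * invFact (suc m))
        ≈⟨ *-congˡ (*-congʳ (trans (signPow-falling (suc m) _) (falling-cong (suc m) reflect))) ⟩
      binomℕ a p * binomℕ (natCast (m ℕ.+ p) - a) (suc m)
        ≡⟨ P.cong (_* binomℕ (natCast (m ℕ.+ p) - a) (suc m)) (binom-[m+p]⊖m a m p) ⟨
      binom a ((m ℕ.+ p) ⊖ m) * binomℕ (natCast (m ℕ.+ p) - a) (suc m) ∎
      where
      reflect : natCast (suc m) - 1# - (a - natCast p) ≈ natCast (m ℕ.+ p) - a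
      reflect = trans (solve 3 (λ x a y → (1ₚ :+ x) :- 1ₚ :- (a :- y) := (x :+ y) :- a) refl _ a _)
                      (+-congʳ (sym (natCast-+ m p)))
    ... | no m≰s with q , P.refl ← ℕP.m≤n⇒∃[o]m+o≡n (ℕP.≰⇒> m≰s) = begin
      binomℕ a (suc s) * (signPow (suc m) * (falling (natCast (suc s)) (suc m) * invFact (suc m)))
        ≈⟨ *-congˡ (*-congˡ (*-congʳ (falling-natCast-vanish (suc s) q))) ⟩
      binomℕ a (suc s) * (signPow (suc m) * (0# * invFact (suc m)))
        ≈⟨ solve 3 (λ b σ i → b :* (σ :* (0ₚ :* i)) := 0ₚ) refl _ _ _ ⟩
      0#
        ≈⟨ zeroˡ _ ⟨
      0# * binomℕ (natCast s - a) (suc m)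
        ≡⟨ P.cong (_* binomℕ (natCast s - a) (suc m)) (binom-⊖-< a (ℕP.≰⇒> m≰s)) ⟨
      binom a (s ⊖ m) * binomℕ (natCast s - a) (suc m) ∎

    Δ^-oneFPS : ∀ d m → Δ^ d oneFPS m ≈ signPow m * binomℕ (natCast d) m
    Δ^-oneFPS zero    zero    = solve 0 (1ₚ := 1ₚ :* (1ₚ :* 1ₚ)) refl
    Δ^-oneFPS zero    (suc m) = sym (trans (*-congˡ (*-congʳ (falling-natCast-vanish 0 m)))
                                           (solve 2 (λ σ i → σ :* (0ₚ :* i) := 0ₚ) refl _ _))
    Δ^-oneFPS (suc d) zero    = Δ^-oneFPS d zero
    Δ^-oneFPS (suc d) (suc m) = begin
      Δ^ d oneFPS (suc m) - Δ^ d oneFPS m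
        ≈⟨ +-cong (Δ^-oneFPS d (suc m)) (-‿cong (Δ^-oneFPS d m)) ⟩
      - signPow m * binomℕ (natCast d) (suc m) - signPow m * binomℕ (natCast d) m
        ≈⟨ solve 3 (λ σ x y → (:- σ) :* x :- σ :* y := (:- σ) :* (x :+ y)) refl _ _ _ ⟩
      - signPow m * (binomℕ (natCast d) (suc m) + binomℕ (natCast d) m)
        ≈⟨ *-congˡ (pascal (natCast d) m) ⟨
      signPow (suc m) * binomℕ (natCast (suc d)) (suc m) ∎

    -- The family G

    module _ (y : Carrier) (n : ℕ) where

      G : ℕ → FPS
      G s k = natCast n * binomℕ (natCast k + y) s - y * binomPred (natCast k + y - 1#) s

      H : ℕ → FPS
      H s m = binom y (s ⊖ m) * ((natCast n - natCast s) * binomℕ (natCast s - y) m + binomPred (natCast s - y) m)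

      G-antidifference : ∀ s k → G (suc s) (suc k) - G (suc s) k ≈ G s k
      G-antidifference s k = begin
        (natCast n * A₁ - y * M₁) - (natCast n * A₀ - y * M₀)
          ≈⟨ +-congʳ (+-cong (*-congˡ A₁≈A₀+A) (-‿cong (*-congˡ M₁≈M₀+M))) ⟩
        (natCast n * (A₀ + A) - y * (M₀ + M)) - (natCast n * A₀ - y * M₀)
          ≈⟨ solve 6 (λ n y a₀ a m₀ m → (n :* (a₀ :+ a) :- y :* (m₀ :+ m)) :- (n :* a₀ :- y :* m₀) := n :* a :- y :* m)
                     refl _ y _ _ _ _ ⟩
        natCast n * A - y * M ∎
        where
        x A₁ A₀ A M₁ M₀ M : Carrier
        x = natCast k + y
        A₁ = binomℕ (natCast (suc k) + y) (suc s)
        A₀ = binomℕ x (suc s)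
        A  = binomℕ x s
        M₁ = binomPred (natCast (suc k) + y - 1#) (suc s)
        M₀ = binomPred (x - 1#) (suc s)
        M  = binomPred (x - 1#) s
        A₁≈A₀+A : A₁ ≈ A₀ + A
        A₁≈A₀+A = trans (binomℕ-cong (suc s) (+-assoc 1# _ _)) (pascal x s)
        M₁≈M₀+M : M₁ ≈ M₀ + M
        M₁≈M₀+M = trans (binomℕ-cong s (solve 2 (λ k y → (1ₚ :+ k) :+ y :- 1ₚ := 1ₚ :+ (k :+ y :- 1ₚ)) refl _ y))
                        (pascal-pred (x - 1#) s)

      G-zero : ∀ s → G s 0 ≈ (natCast n - natCast s) * binomℕ y s
      G-zero s = begin
        natCast n * binomℕ (0# + y) s - y * binomPred (0# + y - 1#) s
          ≈⟨ +-cong (*-congˡ (binomℕ-cong s (+-identityˡ y))) (-‿cong (*-congˡ (binomPred-cong s (+-congʳ (+-identityˡ y))))) ⟩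
        natCast n * binomℕ y s - y * binomPred (y - 1#) s
          ≈⟨ +-congˡ (-‿cong (absorption y s)) ⟩
        natCast n * binomℕ y s - natCast s * binomℕ y s
          ≈⟨ solve 3 (λ n s b → n :* b :- s :* b := (n :- s) :* b) refl _ _ _ ⟩
        (natCast n - natCast s) * binomℕ y s ∎

      G-top : ∀ k → G n k ≈ natCast k * binomPred (natCast k + y - 1#) n
      G-top k = begin
        natCast n * binomℕ (natCast k + y) n - y * B
          ≈⟨ +-congʳ (absorption (natCast k + y) n) ⟨
        (natCast k + y) * B - y * B
          ≈⟨ solve 3 (λ k y b → (k :+ y) :* b :- y :* b := k :* b) refl _ y _ ⟩
        natCast k * B ∎
        where
        B : Carrier
        B = binomPred (natCast k + y - 1#) n

      H-suc : ∀ s m → G (suc s) 0 * (signPow (suc m) * binomℕ (natCast (suc s)) (suc m)) + H s m ≈ H (suc s) (suc m)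
      H-suc s m = begin
        G (suc s) 0 * (signPow (suc m) * binomℕ (natCast (suc s)) (suc m)) + H s m
          ≈⟨ +-congʳ (*-congʳ (G-zero (suc s))) ⟩
        ((natCast n - natCast (suc s)) * binomℕ y (suc s)) * (signPow (suc m) * binomℕ (natCast (suc s)) (suc m)) + H s m
          ≈⟨ +-congʳ (*-assoc _ _ _) ⟩
        (natCast n - natCast (suc s)) * (binomℕ y (suc s) * (signPow (suc m) * binomℕ (natCast (suc s)) (suc m))) + H s m
          ≈⟨ +-congʳ (*-congˡ (binomℕ-signPow-trinomial y s m)) ⟩
        (natCast n - (1# + natCast s)) * (B * X) + B * ((natCast n - natCast s) * Y + Z)
          ≈⟨ solve 6 (λ n s b x y z → (n :- (1ₚ :+ s)) :* (b :* x) :+ b :* ((n :- s) :* y :+ z)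
                                   := b :* ((n :- (1ₚ :+ s)) :* (x :+ y) :+ (y :+ z))) refl _ _ _ _ _ _ ⟩
        B * ((natCast n - natCast (suc s)) * (X + Y) + (Y + Z))
          ≈⟨ *-cong (reflexive (P.cong (binom y) (P.sym (ℤP.[1+m]⊖[1+n]≡m⊖n s m))))
                    (+-cong (*-congˡ (sym (trans (binomℕ-cong (suc m) reassoc) (pascal _ m))))
                            (sym (trans (binomℕ-cong m reassoc) (pascal-pred _ m)))) ⟩
        H (suc s) (suc m) ∎
        where
        B X Y Z : Carrier
        B = binom y (s ⊖ m)
        X = binomℕ (natCast s - y) (suc m)
        Y = binomℕ (natCast s - y) m
        Z = binomPred (natCast s - y) m
        reassoc : natCast (suc s) - y ≈ 1# + (natCast s - y)
        reassoc = +-assoc 1# (natCast s) (- y)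

      Δ^-G : ∀ s → Δ^ (suc s) (G s) ≈ᶠ H s
      Δ^-G zero zero          = solve 2 (λ n y → n :* (1ₚ :* 1ₚ) :- y :* 0ₚ := (1ₚ :* 1ₚ) :* ((n :- 0ₚ) :* (1ₚ :* 1ₚ) :+ 0ₚ)) refl _ y
      Δ^-G zero (suc m)       = trans (-‿inverseʳ _) (sym (zeroˡ _))
      Δ^-G (suc s) zero       = begin
        Δ^ (suc (suc s)) (G (suc s)) 0
          ≈⟨ Δ^-suc-antidifference (suc s) (G-antidifference s) 0 ⟩
        G (suc s) 0 * Δ^ (suc s) oneFPS 0 + 0#
          ≈⟨ trans (+-identityʳ _) (*-cong (G-zero (suc s)) (Δ^-oneFPS (suc s) 0)) ⟩
        ((natCast n - natCast (suc s)) * binomℕ y (suc s)) * (1# * (1# * 1#))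
          ≈⟨ solve 2 (λ d b → (d :* b) :* (1ₚ :* (1ₚ :* 1ₚ)) := b :* (d :* (1ₚ :* 1ₚ) :+ 0ₚ)) refl _ _ ⟩
        H (suc s) 0 ∎
      Δ^-G (suc s) (suc m) = begin
        Δ^ (suc (suc s)) (G (suc s)) (suc m)
          ≈⟨ Δ^-suc-antidifference (suc s) (G-antidifference s) (suc m) ⟩
        G (suc s) 0 * Δ^ (suc s) oneFPS (suc m) + Δ^ (suc s) (G s) m
          ≈⟨ +-cong (*-congˡ (Δ^-oneFPS (suc s) (suc m))) (Δ^-G s m) ⟩
        G (suc s) 0 * (signPow (suc m) * binomℕ (natCast (suc s)) (suc m)) + H s m
          ≈⟨ H-suc s m ⟩
        H (suc s) (suc m) ∎

      Δ^-natCast*binomPred : Δ^ (suc n) (λ k → natCast k * binomPred (natCast k + y - 1#) n)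
                             ≈ᶠ (λ m → binom y (n ⊖ m) * binomPred (natCast n - y) m)
      Δ^-natCast*binomPred m = begin
        Δ^ (suc n) (λ k → natCast k * binomPred (natCast k + y - 1#) n) m
          ≈⟨ Δ^-cong (suc n) (λ k → sym (G-top k)) m ⟩
        Δ^ (suc n) (G n) m
          ≈⟨ Δ^-G n m ⟩
        binom y (n ⊖ m) * ((natCast n - natCast n) * binomℕ (natCast n - y) m + binomPred (natCast n - y) m)
          ≈⟨ *-congˡ (solve 3 (λ n x z → (n :- n) :* x :+ z := z) refl _ _ _) ⟩
        binom y (n ⊖ m) * binomPred (natCast n - y) m ∎

  -- The series of the theorem

  cnm-suc : ∀ β k m → cnm β (suc k) m ≈ inv k * (natCast m * binomPred (natCast m + natCast (suc k) * β - 1#) (suc k))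
  cnm-suc β k m = solve 3 (λ a i b → (a :* i) :* b := i :* (a :* b)) refl _ _ _

  rhs≈ : ∀ β n m → rhs β n m ≈ inv (n ∸ 1) * (binom (natCast n * β) (n ⊖ m) * binomPred (natCast n - natCast n * β) m)
  rhs≈ β n m with m ≤ᵇ n in m≤ᵇn
  ... | true  = *-congˡ (begin
    binomPred (natCast n * (1# - β)) m * binom y (+ n ℤ.- + m)
      ≡⟨ P.cong (λ i → binomPred (natCast n * (1# - β)) m * binom y i) (ℤP.[+m]-[+n]≡m⊖n n m) ⟩
    binomPred (natCast n * (1# - β)) m * binom y (n ⊖ m)
      ≈⟨ *-comm _ _ ⟩
    binom y (n ⊖ m) * binomPred (natCast n * (1# - β)) m
      ≈⟨ *-congˡ (binomPred-cong m (solve 2 (λ n b → n :* (1ₚ :- b) := n :- n :* b) refl _ β)) ⟩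
    binom y (n ⊖ m) * binomPred (natCast n - y) m ∎)
    where
    y : Carrier
    y = natCast n * β
  ... | false = sym (trans (*-congˡ (trans (*-congʳ (reflexive (binom-⊖-< _ n<m))) (zeroˡ _))) (zeroʳ _))
    where
    n<m : n < m
    n<m = ℕP.≰⇒> (λ m≤n → P.subst T m≤ᵇn (ℕP.≤⇒≤ᵇ m≤n))

theorem2p5 : ∀ {c ℓ} (R : CommutativeRing c ℓ) (inv : ℕ → CommutativeRing.Carrier R) →
    (∀ k → CommutativeRing._≈_ R (CommutativeRing._*_ R (Over.natCast R inv (suc k)) (inv k)) (CommutativeRing.1# R)) →
    (β : CommutativeRing.Carrier R) (n : ℕ) → 1 ≤ n →
    ∀ m → CommutativeRing._≈_ R (Over.alpha R inv β n m) (Over.rhs R inv β n m)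
theorem2p5 R inv natCast-inv β (suc k) _ m = begin
  alpha β n m                                             ≈⟨ oneMinusX^-· (suc n) (cnm β n) m ⟩
  Δ^ (suc n) (cnm β n) m                                  ≈⟨ Δ^-cong (suc n) (cnm-suc β k) m ⟩
  Δ^ (suc n) (λ j → inv k * f j) m                        ≈⟨ Δ^-scale (suc n) (inv k) f m ⟩
  inv k * Δ^ (suc n) f m                                  ≈⟨ *-congˡ (Δ^-natCast*binomPred natCast-inv y n m) ⟩
  inv k * (binom y (n ⊖ m) * binomPred (natCast n - y) m) ≈⟨ rhs≈ β n m ⟨
  rhs β n m                                               ∎
  where
  open CommutativeRing R
  open Over R inv
  open FiniteCalculus R inv
  open import Relation.Binary.Reasoning.Setoid setoid
  n : ℕ
  n = suc k
  y : Carrier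
  y = natCast n * β
  f : FPS
  f j = natCast j * binomPred (natCast j + y - 1#) n
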